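{- Let $\pi$ be a proof strategy with initial capital $\delta$. Then the probability that the theory $T$ built by $\pi$ contains some false statement (i.e., a statement false in the standard model of arithmetic) is at most $\delta$.
   Context: $\mathsf{PA}$ denotes Peano arithmetic. For a finite set $A$ of natural numbers, a rational $\tau>0$ and an arithmetical formula $R(x)$ with one free variable, $(\forall_\tau x\in A)R(x)$ denotes the arithmetical statement "the proportion of elements $n$ of $A$ such that $\lnot R(n)$ holds is at most $\tau$"; here $A$ is represented by a formula $A(x)$ such that $\mathsf{PA}\vdash A(\bar n)$ for $n\in A$, $\mathsf{PA}\vdash \lnot A(\bar n)$ for $n\notin A$, and the cardinality of $A$ is provable in $\mathsf{PA}$. A proof strategy with initial capital $\varepsilon$ is a finite rooted tree whose nodes are labeled by pairs $(T,\delta)$, $T$ a set of formulas and $\delta$ a rational in $[0,1]$; the root is labeled $(\mathsf{PA},\varepsilon)$. Each non-leaf node is either deterministic: it has one child, labeled $(T\cup\{\psi\},\delta)$ where $\psi$ is obtained from $T$ by an inference rule (or is an axiom); or probabilistic: $T$ contains a formula $(\forall_\tau n\in A)R(n)$ with $\tau\le\delta$, and the node has one child for each $n\in A$, labeled $(T\cup\{R(\bar n)\},\delta-\tau)$. The strategy is identified with the random process that starts at the root and at each probabilistic node moves to a uniformly chosen child until a leaf is reached; the theory built by $\pi$ is the (random) set of formulas $T$ in the label of the leaf reached. -}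

module Defs where

open import Data.Nat as ℕ using (ℕ; zero; suc)
open import Data.Integer using (+_)
open import Data.Rational using (ℚ; 0ℚ; 1ℚ; _/_; _+_; _*_; _-_; _≤_; _<_)
open import Data.Fin using (Fin; zero; suc)
open import Data.Bool using (Bool; true; false; if_then_else_)
open import Data.List using (List; []; _∷_)
open import Data.List.Membership.Propositional using (_∈_)
open import Data.Empty using (⊥)
open import Data.Product using (_×_; ∃-syntax)
open import Data.Sum using (_⊎_)
open import Relation.Binary.PropositionalEquality using (_≡_)
open import Relation.Nullary using (¬_)
open import Function.Definitions using (Injective)

data Term : Set where
  var : ℕ → Term
  zer : Term
  sc  : Term → Term
  _⊕_ : Term → Term → Term
  _⊗_ : Term → Term → Term

data Formula : Set where
  _≐_ : Term → Term → Formula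
  ⊥f  : Formula
  _⇒_ : Formula → Formula → Formula
  ∀f  : Formula → Formula

infix 6 _≐_
infixr 5 _⇒_

renT : (ℕ → ℕ) → Term → Term
renT r (var x) = var (r x)
renT r zer = zer
renT r (sc t) = sc (renT r t)
renT r (t ⊕ u) = renT r t ⊕ renT r u
renT r (t ⊗ u) = renT r t ⊗ renT r u

substT : (ℕ → Term) → Term → Term
substT σ (var x) = σ x
substT σ zer = zer
substT σ (sc t) = sc (substT σ t)
substT σ (t ⊕ u) = substT σ t ⊕ substT σ u
substT σ (t ⊗ u) = substT σ t ⊗ substT σ u

exts : (ℕ → Term) → ℕ → Term
exts σ zero = var zero
exts σ (suc n) = renT suc (σ n)

substF : (ℕ → Term) → Formula → Formula
substF σ (t ≐ u) = substT σ t ≐ substT σ u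
substF σ ⊥f = ⊥f
substF σ (φ ⇒ ψ) = substF σ φ ⇒ substF σ ψ
substF σ (∀f φ) = ∀f (substF (exts σ) φ)

_∷σ_ : Term → (ℕ → Term) → ℕ → Term
(t ∷σ σ) zero = t
(t ∷σ σ) (suc n) = σ n

_[_] : Formula → Term → Formula
φ [ t ] = substF (t ∷σ var) φ

shift : Formula → Formula
shift = substF (λ n → var (suc n))

¬f : Formula → Formula
¬f φ = φ ⇒ ⊥f

num : ℕ → Term
num zero = zer
num (suc n) = sc (num n)

data TBound (m : ℕ) : Term → Set where
  var : ∀ {x} → x ℕ.< m → TBound m (var x)
  zer : TBound m zer
  sc  : ∀ {t} → TBound m t → TBound m (sc t)
  add : ∀ {t u} → TBound m t → TBound m u → TBound m (t ⊕ u)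
  mul : ∀ {t u} → TBound m t → TBound m u → TBound m (t ⊗ u)

data FBound : ℕ → Formula → Set where
  eq  : ∀ {m t u} → TBound m t → TBound m u → FBound m (t ≐ u)
  bot : ∀ {m} → FBound m ⊥f
  imp : ∀ {m φ ψ} → FBound m φ → FBound m ψ → FBound m (φ ⇒ ψ)
  all : ∀ {m φ} → FBound (suc m) φ → FBound m (∀f φ)

Env : Set
Env = ℕ → ℕ

_∷ₑ_ : ℕ → Env → Env
(n ∷ₑ ρ) zero = n
(n ∷ₑ ρ) (suc k) = ρ k

⟦_⟧ : Term → Env → ℕ
⟦ var x ⟧ ρ = ρ x
⟦ zer ⟧ ρ = zero
⟦ sc t ⟧ ρ = suc (⟦ t ⟧ ρ)
⟦ t ⊕ u ⟧ ρ = ⟦ t ⟧ ρ ℕ.+ ⟦ u ⟧ ρ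
⟦ t ⊗ u ⟧ ρ = ⟦ t ⟧ ρ ℕ.* ⟦ u ⟧ ρ

Sat : Formula → Env → Set
Sat (t ≐ u) ρ = ⟦ t ⟧ ρ ≡ ⟦ u ⟧ ρ
Sat ⊥f ρ = ⊥
Sat (φ ⇒ ψ) ρ = Sat φ ρ → Sat ψ ρ
Sat (∀f φ) ρ = (n : ℕ) → Sat φ (n ∷ₑ ρ)

-- truth in the standard model (of the universal closure)
True : Formula → Set
True φ = (ρ : Env) → Sat φ ρ

data LogAx : Formula → Set where
  ax-K : ∀ φ ψ → LogAx (φ ⇒ ψ ⇒ φ)
  ax-S : ∀ φ ψ χ → LogAx ((φ ⇒ ψ ⇒ χ) ⇒ (φ ⇒ ψ) ⇒ φ ⇒ χ)
  ax-DN : ∀ φ → LogAx (¬f (¬f φ) ⇒ φ)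
  ax-inst : ∀ φ t → LogAx (∀f φ ⇒ φ [ t ])
  ax-dist : ∀ φ ψ → LogAx (∀f (shift φ ⇒ ψ) ⇒ φ ⇒ ∀f ψ)
  ax-refl : ∀ t → LogAx (t ≐ t)
  ax-subst : ∀ φ s t → LogAx (s ≐ t ⇒ φ [ s ] ⇒ φ [ t ])

private
  v0 v1 : Term
  v0 = var 0
  v1 = var 1

data PAAx : Formula → Set where
  pa-zero : PAAx (∀f (¬f (sc v0 ≐ zer)))
  pa-inj  : PAAx (∀f (∀f (sc v1 ≐ sc v0 ⇒ v1 ≐ v0)))
  pa-add0 : PAAx (∀f (v0 ⊕ zer ≐ v0))
  pa-addS : PAAx (∀f (∀f (v1 ⊕ sc v0 ≐ sc (v1 ⊕ v0))))
  pa-mul0 : PAAx (∀f (v0 ⊗ zer ≐ zer))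
  pa-mulS : PAAx (∀f (∀f (v1 ⊗ sc v0 ≐ (v1 ⊗ v0) ⊕ v1)))
  pa-ind  : ∀ φ → PAAx (φ [ zer ] ⇒ ∀f (φ ⇒ substF (sc (var 0) ∷σ (λ n → var (suc n))) φ) ⇒ ∀f φ)

InTh : List Formula → Formula → Set
InTh L φ = PAAx φ ⊎ φ ∈ L

data Step (T : List Formula) : Formula → Set where
  logax : ∀ {ψ} → LogAx ψ → Step T ψ
  paax  : ∀ {ψ} → PAAx ψ → Step T ψ
  mp    : ∀ {φ ψ} → InTh T φ → InTh T (φ ⇒ ψ) → Step T ψ
  gen   : ∀ {φ} → InTh T φ → Step T (∀f φ)

sumℚ : ∀ {k} → (Fin k → ℚ) → ℚ
sumℚ {zero} f = 0ℚ
sumℚ {suc k} f = f zero + sumℚ (λ i → f (suc i))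

count : ∀ {k} → (Fin k → Bool) → ℕ
count {zero} S = zero
count {suc k} S = (if S zero then 1 else 0) ℕ.+ count (λ i → S (suc i))

-- "(∀_τ n ∈ A) R(n)" (semantic content), A = {A 0, …, A k} (A injective):
-- every (decidably given) set of elements of A at which R fails has size ≤ τ·|A|.
PropAtMost : ℚ → (k : ℕ) → (Fin (suc k) → ℕ) → Formula → Set
PropAtMost τ k A R =
  (S : Fin (suc k) → Bool) →
  ((i : Fin (suc k)) → S i ≡ true → ¬ True (R [ num (A i) ])) →
  (+ count S / 1) ≤ τ * (+ suc k / 1)

-- Proof strategies: Strategy T δ is a tree whose root is labelled (PA ∪ T, δ)

data Strategy : List Formula → ℚ → Set where
  leaf : ∀ {T δ} → Strategy T δ
  det  : ∀ {T δ} (ψ : Formula) → Step T ψ → Strategy (ψ ∷ T) δ → Strategy T δ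
  prob : ∀ {T δ} (τ : ℚ) → 0ℚ < τ → τ ≤ δ →
         (φ : Formula) → InTh T φ →
         (k : ℕ) (A : Fin (suc k) → ℕ) → Injective _≡_ _≡_ A →
         (R : Formula) → FBound 1 R →
         -- φ is an arithmetical sentence expressing (∀_τ n ∈ A) R(n)
         FBound 0 φ → (True φ → PropAtMost τ k A R) → (PropAtMost τ k A R → True φ) →
         ((i : Fin (suc k)) → Strategy (R [ num (A i) ] ∷ T) (δ - τ)) →
         Strategy T δ

-- probability that the theory at the reached leaf satisfies the (decidable) marking m
Pr : ∀ {T δ} → Strategy T δ → (List Formula → Bool) → ℚ
Pr {T} leaf m = if m T then 1ℚ else 0ℚ
Pr (det ψ _ s) m = Pr s m
Pr (prob τ _ _ φ _ k A _ R _ _ _ _ c) m = (+ 1 / suc k) * sumℚ (λ i → Pr (c i) m)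

HasFalse : List Formula → Set
HasFalse L = ∃[ φ ] (InTh L φ × ¬ True φ)

module Submission where

-- Call a theory sound when every formula of PA ∪ T is true in ℕ.  All
-- logical and PA axioms are true and the inference rules preserve truth,
-- so a deterministic node keeps a sound theory sound.  At a probabilistic
-- node (T, δ) with T sound, the sentence (∀_τ n ∈ A) R(n) of T is true,
-- so the children i at which R(A i) is false form a set S with |S| ≤ τ|A|.
-- Off S the child theory is again sound and (by induction, with capital
-- δ - τ) errs with probability ≤ δ - τ; on S it errs with probability ≤ 1.
-- Averaging over the children gives ≤ τ + (δ - τ) = δ.

open import Defs
open import Data.Rational using (ℚ; 0ℚ; 1ℚ; _≤_)
open import Data.List using (List; [])
open import Data.Bool using (Bool; true)
open import Relation.Binary.PropositionalEquality using (_≡_)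

open import Data.Nat as ℕ using (ℕ; zero; suc)
import Data.Nat.Properties as ℕ
open import Data.Integer as ℤ using (+_)
import Data.Integer.Properties as ℤ
open import Data.Rational using (_/_; _+_; _*_; _-_; -_; toℚᵘ; _≤?_)
open import Data.Rational.Properties
  using (≤-refl; ≤-trans; ≤-reflexive; +-mono-≤; +-monoʳ-≤; +-monoˡ-≤; *-monoˡ-≤-nonNeg;
         +-identityˡ; +-identityʳ; +-inverseʳ; *-assoc; *-identityˡ; *-zeroˡ; normalize-nonNeg; nonNegative⁻¹;
         module ≤-Reasoning;
         toℚᵘ-injective; toℚᵘ-homo-+; toℚᵘ-homo-*; toℚᵘ-fromℚᵘ)
open import Data.Rational.Unnormalised as ℚᵘ using (mkℚᵘ; *≡*)
import Data.Rational.Unnormalised.Properties as ℚᵘ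
open import Data.Rational.Solver using (module +-*-Solver)
open import Data.Integer.Solver renaming (module +-*-Solver to ℤSolver)
open import Data.Fin using (Fin; zero; suc)
open import Data.Bool using (false; if_then_else_)
open import Data.List using (_∷_)
open import Data.List.Relation.Unary.Any using (here; there)
open import Data.Empty using (⊥-elim)
open import Data.Product using (_,_)
open import Data.Sum using (inj₁; inj₂)
open import Relation.Binary.PropositionalEquality
  using (refl; sym; trans; cong; cong₂; subst)
open import Relation.Nullary using (¬_; yes; no)

-- Pointwise equality of environments (without function extensionality,
-- all environment equalities are stated pointwise).
_≗ₑ_ : Env → Env → Set
ρ ≗ₑ ρ' = ∀ x → ρ x ≡ ρ' x

⟦⟧-cong : ∀ t {ρ ρ'} → ρ ≗ₑ ρ' → ⟦ t ⟧ ρ ≡ ⟦ t ⟧ ρ'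
⟦⟧-cong (var x) e = e x
⟦⟧-cong zer e = refl
⟦⟧-cong (sc t) e = cong suc (⟦⟧-cong t e)
⟦⟧-cong (t ⊕ u) e = cong₂ ℕ._+_ (⟦⟧-cong t e) (⟦⟧-cong u e)
⟦⟧-cong (t ⊗ u) e = cong₂ ℕ._*_ (⟦⟧-cong t e) (⟦⟧-cong u e)

∷ₑ-cong : ∀ n {ρ ρ'} → ρ ≗ₑ ρ' → (n ∷ₑ ρ) ≗ₑ (n ∷ₑ ρ')
∷ₑ-cong n e zero = refl
∷ₑ-cong n e (suc x) = e x

Sat-cong : ∀ φ {ρ ρ'} → ρ ≗ₑ ρ' → Sat φ ρ → Sat φ ρ'
Sat-cong (t ≐ u) e s = trans (sym (⟦⟧-cong t e)) (trans s (⟦⟧-cong u e))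
Sat-cong ⊥f e s = s
Sat-cong (φ ⇒ ψ) e s a = Sat-cong ψ e (s (Sat-cong φ (λ x → sym (e x)) a))
Sat-cong (∀f φ) e s n = Sat-cong φ (∷ₑ-cong n e) (s n)

⟦renT⟧ : ∀ r t ρ → ⟦ renT r t ⟧ ρ ≡ ⟦ t ⟧ (λ x → ρ (r x))
⟦renT⟧ r (var x) ρ = refl
⟦renT⟧ r zer ρ = refl
⟦renT⟧ r (sc t) ρ = cong suc (⟦renT⟧ r t ρ)
⟦renT⟧ r (t ⊕ u) ρ = cong₂ ℕ._+_ (⟦renT⟧ r t ρ) (⟦renT⟧ r u ρ)
⟦renT⟧ r (t ⊗ u) ρ = cong₂ ℕ._*_ (⟦renT⟧ r t ρ) (⟦renT⟧ r u ρ)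

⟦substT⟧ : ∀ σ t ρ → ⟦ substT σ t ⟧ ρ ≡ ⟦ t ⟧ (λ x → ⟦ σ x ⟧ ρ)
⟦substT⟧ σ (var x) ρ = refl
⟦substT⟧ σ zer ρ = refl
⟦substT⟧ σ (sc t) ρ = cong suc (⟦substT⟧ σ t ρ)
⟦substT⟧ σ (t ⊕ u) ρ = cong₂ ℕ._+_ (⟦substT⟧ σ t ρ) (⟦substT⟧ σ u ρ)
⟦substT⟧ σ (t ⊗ u) ρ = cong₂ ℕ._*_ (⟦substT⟧ σ t ρ) (⟦substT⟧ σ u ρ)

⟦exts⟧ : ∀ σ n ρ → (λ x → ⟦ exts σ x ⟧ (n ∷ₑ ρ)) ≗ₑ (n ∷ₑ (λ y → ⟦ σ y ⟧ ρ))
⟦exts⟧ σ n ρ zero = refl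
⟦exts⟧ σ n ρ (suc y) = ⟦renT⟧ suc (σ y) (n ∷ₑ ρ)

mutual
  Sat-substF→ : ∀ φ σ ρ → Sat (substF σ φ) ρ → Sat φ (λ x → ⟦ σ x ⟧ ρ)
  Sat-substF→ (t ≐ u) σ ρ s = trans (sym (⟦substT⟧ σ t ρ)) (trans s (⟦substT⟧ σ u ρ))
  Sat-substF→ ⊥f σ ρ s = s
  Sat-substF→ (φ ⇒ ψ) σ ρ s a = Sat-substF→ ψ σ ρ (s (Sat-substF← φ σ ρ a))
  Sat-substF→ (∀f φ) σ ρ s n =
    Sat-cong φ (⟦exts⟧ σ n ρ) (Sat-substF→ φ (exts σ) (n ∷ₑ ρ) (s n))

  Sat-substF← : ∀ φ σ ρ → Sat φ (λ x → ⟦ σ x ⟧ ρ) → Sat (substF σ φ) ρ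
  Sat-substF← (t ≐ u) σ ρ s = trans (⟦substT⟧ σ t ρ) (trans s (sym (⟦substT⟧ σ u ρ)))
  Sat-substF← ⊥f σ ρ s = s
  Sat-substF← (φ ⇒ ψ) σ ρ s a = Sat-substF← ψ σ ρ (s (Sat-substF→ φ σ ρ a))
  Sat-substF← (∀f φ) σ ρ s n =
    Sat-substF← φ (exts σ) (n ∷ₑ ρ) (Sat-cong φ (λ x → sym (⟦exts⟧ σ n ρ x)) (s n))

⟦∷σ⟧ : ∀ t ρ → (λ x → ⟦ (t ∷σ var) x ⟧ ρ) ≗ₑ (⟦ t ⟧ ρ ∷ₑ ρ)
⟦∷σ⟧ t ρ zero = refl
⟦∷σ⟧ t ρ (suc x) = refl

Sat-inst→ : ∀ φ t ρ → Sat (φ [ t ]) ρ → Sat φ (⟦ t ⟧ ρ ∷ₑ ρ)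
Sat-inst→ φ t ρ s = Sat-cong φ (⟦∷σ⟧ t ρ) (Sat-substF→ φ (t ∷σ var) ρ s)

Sat-inst← : ∀ φ t ρ → Sat φ (⟦ t ⟧ ρ ∷ₑ ρ) → Sat (φ [ t ]) ρ
Sat-inst← φ t ρ s = Sat-substF← φ (t ∷σ var) ρ (Sat-cong φ (λ x → sym (⟦∷σ⟧ t ρ x)) s)

-- Satisfaction in ℕ is stable under double negation (equality of
-- naturals is decidable), which validates the classical axiom ax-DN.
Sat-stable : ∀ φ ρ → ¬ ¬ Sat φ ρ → Sat φ ρ
Sat-stable (t ≐ u) ρ ¬¬s with ⟦ t ⟧ ρ ℕ.≟ ⟦ u ⟧ ρ
... | yes t≡u = t≡u
... | no t≢u = ⊥-elim (¬¬s t≢u)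
Sat-stable ⊥f ρ ¬¬s = ¬¬s (λ s → s)
Sat-stable (φ ⇒ ψ) ρ ¬¬s a = Sat-stable ψ ρ (λ ¬b → ¬¬s (λ f → ¬b (f a)))
Sat-stable (∀f φ) ρ ¬¬s n = Sat-stable φ (n ∷ₑ ρ) (λ ¬b → ¬¬s (λ f → ¬b (f n)))

LogAx-true : ∀ {ψ} → LogAx ψ → True ψ
LogAx-true (ax-K φ ψ) ρ a b = a
LogAx-true (ax-S φ ψ χ) ρ f g a = f a (g a)
LogAx-true (ax-DN φ) ρ ¬¬a = Sat-stable φ ρ ¬¬a
LogAx-true (ax-inst φ t) ρ s = Sat-inst← φ t ρ (s (⟦ t ⟧ ρ))
LogAx-true (ax-dist φ ψ) ρ s a n = s n (Sat-substF← φ (λ m → var (suc m)) (n ∷ₑ ρ) a)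
LogAx-true (ax-refl t) ρ = refl
LogAx-true (ax-subst φ s t) ρ s≡t a =
  Sat-inst← φ t ρ (subst (λ v → Sat φ (v ∷ₑ ρ)) s≡t (Sat-inst→ φ s ρ a))

PAAx-true : ∀ {ψ} → PAAx ψ → True ψ
PAAx-true pa-zero ρ n ()
PAAx-true pa-inj ρ a b = ℕ.suc-injective
PAAx-true pa-add0 ρ n = ℕ.+-identityʳ n
PAAx-true pa-addS ρ a b = ℕ.+-suc a b
PAAx-true pa-mul0 ρ n = ℕ.*-zeroʳ n
PAAx-true pa-mulS ρ a b = trans (ℕ.*-suc a b) (ℕ.+-comm a (a ℕ.* b))
PAAx-true (pa-ind φ) ρ base step = induction
  where
    succ-env : ∀ n → (λ x → ⟦ (sc (var 0) ∷σ (λ m → var (suc m))) x ⟧ (n ∷ₑ ρ))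
                     ≗ₑ (suc n ∷ₑ ρ)
    succ-env n zero = refl
    succ-env n (suc x) = refl

    induction : ∀ n → Sat φ (n ∷ₑ ρ)
    induction zero = Sat-inst→ φ zer ρ base
    induction (suc n) =
      Sat-cong φ (succ-env n) (Sat-substF→ φ _ (n ∷ₑ ρ) (step n (induction n)))

Sound : List Formula → Set
Sound T = ∀ φ → InTh T φ → True φ

PA-sound : Sound []
PA-sound φ (inj₁ ax) = PAAx-true ax
PA-sound φ (inj₂ ())

Step-true : ∀ {T ψ} → Sound T → Step T ψ → True ψ
Step-true sound (logax ax) = LogAx-true ax
Step-true sound (paax ax) = PAAx-true ax
Step-true sound (mp a a⇒b) ρ = sound _ a⇒b ρ (sound _ a ρ)
Step-true sound (gen a) ρ n = sound _ a (n ∷ₑ ρ)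

Sound-∷ : ∀ {T ψ} → Sound T → True ψ → Sound (ψ ∷ T)
Sound-∷ sound t φ (inj₁ ax) = sound φ (inj₁ ax)
Sound-∷ sound t φ (inj₂ (here refl)) = t
Sound-∷ sound t φ (inj₂ (there φ∈T)) = sound φ (inj₂ φ∈T)

toℚ : ℕ → ℚ
toℚ n = + n / 1

toℚ≃ : ∀ n → toℚᵘ (toℚ n) ℚᵘ.≃ mkℚᵘ (+ n) 0
toℚ≃ n = toℚᵘ-fromℚᵘ (mkℚᵘ (+ n) 0)

toℚ-+ : ∀ a b → toℚ (a ℕ.+ b) ≡ toℚ a + toℚ b
toℚ-+ a b = toℚᵘ-injective (begin
    toℚᵘ (toℚ (a ℕ.+ b))                      ≈⟨ toℚ≃ (a ℕ.+ b) ⟩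
    mkℚᵘ (+ (a ℕ.+ b)) 0                       ≈⟨ *≡* integral ⟩
    mkℚᵘ (+ a) 0 ℚᵘ.+ mkℚᵘ (+ b) 0             ≈⟨ ℚᵘ.+-cong (toℚ≃ a) (toℚ≃ b) ⟨
    toℚᵘ (toℚ a) ℚᵘ.+ toℚᵘ (toℚ b)             ≈⟨ toℚᵘ-homo-+ (toℚ a) (toℚ b) ⟨
    toℚᵘ (toℚ a + toℚ b)                      ∎)
  where
  open ℚᵘ.≃-Reasoning
  integral : + (a ℕ.+ b) ℤ.* + 1 ≡ (+ a ℤ.* + 1 ℤ.+ + b ℤ.* + 1) ℤ.* + 1
  integral = trans (ℤ.*-identityʳ _) (trans (ℤ.pos-+ a b) (+-form (+ a) (+ b)))
    where
    open ℤSolver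
    +-form : ∀ x y → x ℤ.+ y ≡ (x ℤ.* + 1 ℤ.+ y ℤ.* + 1) ℤ.* + 1
    +-form = solve 2 (λ x y → x :+ y := (x :* con (+ 1) :+ y :* con (+ 1)) :* con (+ 1)) refl

average : ∀ k → (Fin (suc k) → ℚ) → ℚ
average k f = (+ 1 / suc k) * sumℚ f

inverse-suc : ∀ k → (+ 1 / suc k) * toℚ (suc k) ≡ 1ℚ
inverse-suc k = toℚᵘ-injective (begin
    toℚᵘ ((+ 1 / suc k) * toℚ (suc k))                 ≈⟨ toℚᵘ-homo-* (+ 1 / suc k) (toℚ (suc k)) ⟩
    toℚᵘ (+ 1 / suc k) ℚᵘ.* toℚᵘ (toℚ (suc k))         ≈⟨ ℚᵘ.*-cong (toℚᵘ-fromℚᵘ (mkℚᵘ (+ 1) k)) (toℚ≃ (suc k)) ⟩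
    mkℚᵘ (+ 1) k ℚᵘ.* mkℚᵘ (+ suc k) 0                 ≈⟨ *≡* integral ⟩
    toℚᵘ 1ℚ                                            ∎)
  where
  open ℚᵘ.≃-Reasoning
  integral : (+ 1 ℤ.* + suc k) ℤ.* + 1 ≡ + 1 ℤ.* + (suc k ℕ.* 1)
  integral = trans (ℤ.*-identityʳ _) (cong (λ n → + 1 ℤ.* + n) (sym (ℕ.*-identityʳ (suc k))))

indicator : Bool → ℚ
indicator b = if b then 1ℚ else 0ℚ

toℚ-indicator : ∀ b → toℚ (if b then 1 else 0) ≡ indicator b
toℚ-indicator true = refl
toℚ-indicator false = refl

sum-bound : ∀ {k} (f : Fin k → ℚ) (S : Fin k → Bool) d →
  (∀ i → f i ≤ indicator (S i) + d) → sumℚ f ≤ toℚ (count S) + toℚ k * d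
sum-bound {zero} f S d f≤ = ≤-reflexive (sym (trans (+-identityˡ _) (*-zeroˡ d)))
sum-bound {suc k} f S d f≤ = begin
  f zero + sumℚ (λ i → f (suc i))
    ≤⟨ +-mono-≤ (f≤ zero) (sum-bound (λ i → f (suc i)) S′ d (λ i → f≤ (suc i))) ⟩
  (B + d) + (C + K * d)              ≡⟨ regroup B d C K ⟩
  (B + C) + (1ℚ + K) * d             ≡⟨ cong₂ (λ u v → u + v * d) count-step (sym (toℚ-+ 1 k)) ⟩
  toℚ (count S) + toℚ (suc k) * d    ∎
  where
  open ≤-Reasoning
  S′ : Fin k → Bool
  S′ i = S (suc i)
  B C K : ℚ
  B = indicator (S zero)
  C = toℚ (count S′)
  K = toℚ k
  count-step : B + C ≡ toℚ (count S)
  count-step = sym (trans (toℚ-+ (if S zero then 1 else 0) (count S′))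
                          (cong (_+ C) (toℚ-indicator (S zero))))
  regroup : ∀ B d C K → (B + d) + (C + K * d) ≡ (B + C) + (1ℚ + K) * d
  regroup = solve 4 (λ B d C K → (B :+ d) :+ (C :+ K :* d) := (B :+ C) :+ (con 1ℚ :+ K) :* d) refl
    where open +-*-Solver

average-bound : ∀ k (f : Fin (suc k) → ℚ) (S : Fin (suc k) → Bool) τ d →
  (∀ i → f i ≤ indicator (S i) + d) → toℚ (count S) ≤ τ * toℚ (suc k) →
  average k f ≤ τ + d
average-bound k f S τ d f≤ |S|≤ = begin
  w * sumℚ f                          ≤⟨ scale (sum-bound f S d f≤) ⟩
  w * (toℚ (count S) + N * d)         ≤⟨ scale (+-monoˡ-≤ (N * d) |S|≤) ⟩
  w * (τ * N + N * d)                 ≡⟨ cong (w *_) (factor τ d N) ⟩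
  w * (N * (τ + d))                   ≡⟨ *-assoc w N (τ + d) ⟨
  (w * N) * (τ + d)                   ≡⟨ cong (_* (τ + d)) (inverse-suc k) ⟩
  1ℚ * (τ + d)                        ≡⟨ *-identityˡ (τ + d) ⟩
  τ + d                               ∎
  where
  open ≤-Reasoning
  w N : ℚ
  w = + 1 / suc k
  N = toℚ (suc k)
  scale : ∀ {x y} → x ≤ y → w * x ≤ w * y
  scale = *-monoˡ-≤-nonNeg w {{normalize-nonNeg 1 (suc k)}}
  factor : ∀ τ d N → τ * N + N * d ≡ N * (τ + d)
  factor = solve 3 (λ τ d N → τ :* N :+ N :* d := N :* (τ :+ d)) refl
    where open +-*-Solver

exceeds : ℚ → ℚ → Bool
exceeds p d with p ≤? d
... | yes _ = false
... | no _ = true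

exceeds⇒≰ : ∀ {p d} → exceeds p d ≡ true → ¬ p ≤ d
exceeds⇒≰ {p} {d} e with p ≤? d
exceeds⇒≰ () | yes _
... | no p≰d = p≰d

≤-indicator-exceeds : ∀ {p d} → p ≤ 1ℚ → 0ℚ ≤ d → p ≤ indicator (exceeds p d) + d
≤-indicator-exceeds {p} {d} p≤1 0≤d with p ≤? d
... | yes p≤d = ≤-trans p≤d (≤-reflexive (sym (+-identityˡ d)))
... | no _ = ≤-trans p≤1 (≤-trans (≤-reflexive (sym (+-identityʳ 1ℚ))) (+-monoʳ-≤ 1ℚ 0≤d))

0≤1 : 0ℚ ≤ 1ℚ
0≤1 = nonNegative⁻¹ 1ℚ

Pr≤1 : ∀ {T δ} (π : Strategy T δ) (m : List Formula → Bool) → Pr π m ≤ 1ℚ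
Pr≤1 {T} leaf m with m T
... | true = ≤-refl
... | false = 0≤1
Pr≤1 (det ψ _ π) m = Pr≤1 π m
Pr≤1 (prob τ _ _ φ _ k A _ R _ _ _ _ child) m =
  ≤-trans (average-bound k f (λ _ → false) 0ℚ 1ℚ f≤ no-exceptions)
          (≤-reflexive (+-identityˡ 1ℚ))
  where
  f : Fin (suc k) → ℚ
  f i = Pr (child i) m
  f≤ : ∀ i → f i ≤ 0ℚ + 1ℚ
  f≤ i = ≤-trans (Pr≤1 (child i) m) (≤-reflexive (sym (+-identityˡ 1ℚ)))
  count-false : ∀ n → toℚ (count {n} (λ _ → false)) ≡ 0ℚ
  count-false zero = refl
  count-false (suc n) = count-false n
  no-exceptions : toℚ (count {suc k} (λ _ → false)) ≤ 0ℚ * toℚ (suc k)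
  no-exceptions = ≤-reflexive (trans (count-false (suc k)) (sym (*-zeroˡ (toℚ (suc k)))))

0≤q-p : ∀ {p q} → p ≤ q → 0ℚ ≤ q - p
0≤q-p {p} {q} p≤q = subst (_≤ q - p) (+-inverseʳ p) (+-monoˡ-≤ (- p) p≤q)

p+[q-p]≡q : ∀ p q → p + (q - p) ≡ q
p+[q-p]≡q = solve 2 (λ p q → p :+ (q :- p) := q) refl
  where open +-*-Solver

module _ (m : List Formula → Bool)
         (marked⇒false : (L : List Formula) → m L ≡ true → HasFalse L) where

  Pr≤capital : ∀ {T δ} (π : Strategy T δ) → 0ℚ ≤ δ → Sound T → Pr π m ≤ δ
  Pr≤capital {T} leaf 0≤δ sound with m T in marked
  ... | true  = let (φ , φ∈T , φ-false) = marked⇒false T marked in ⊥-elim (φ-false (sound φ φ∈T))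
  ... | false = 0≤δ
  Pr≤capital (det ψ step π) 0≤δ sound =
    Pr≤capital π 0≤δ (Sound-∷ sound (Step-true sound step))
  Pr≤capital {T} {δ} (prob τ _ τ≤δ φ φ∈T k A _ R _ _ φ⇒fraction _ child) 0≤δ sound =
    subst (average k f ≤_) (p+[q-p]≡q τ δ) (average-bound k f S τ (δ - τ) f≤ |S|≤τ|A|)
    where
    0≤δ-τ : 0ℚ ≤ δ - τ
    0≤δ-τ = 0≤q-p τ≤δ

    f : Fin (suc k) → ℚ
    f i = Pr (child i) m

    S : Fin (suc k) → Bool
    S i = exceeds (f i) (δ - τ)

    -- R(A i) is false at an exceptional child: were it true, the child's
    -- theory would be sound and the induction hypothesis would bound f i.
    S⇒false : ∀ i → S i ≡ true → ¬ True (R [ num (A i) ])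
    S⇒false i exceptional R-true =
      exceeds⇒≰ exceptional (Pr≤capital (child i) 0≤δ-τ (Sound-∷ sound R-true))

    |S|≤τ|A| : toℚ (count S) ≤ τ * toℚ (suc k)
    |S|≤τ|A| = φ⇒fraction (sound φ φ∈T) S S⇒false

    f≤ : ∀ i → f i ≤ indicator (S i) + (δ - τ)
    f≤ i = ≤-indicator-exceeds (Pr≤1 (child i) m) 0≤δ-τ

theorem1 : (δ : ℚ) → 0ℚ ≤ δ → δ ≤ 1ℚ → (π : Strategy [] δ) →
    (m : List Formula → Bool) → ((L : List Formula) → m L ≡ true → HasFalse L) →
    Pr π m ≤ δ
theorem1 δ 0≤δ _ π m marked⇒false = Pr≤capital m marked⇒false π 0≤δ PA-sound
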